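{- Let $G=(V,E,w)$ be a finite graph with positive edge weights and $h(A)=\sum_{v\in V}h_A(v)$, where $h_A(v)=W(v)/2$ if $v\in A$ or $W_A(v)\ge W(v)/2$, and $h_A(v)=W_A(v)$ otherwise. A set $S\subseteq V$ is a weighted partial positive influence dominating set if and only if $h(S)=\max_{X\subseteq V}h(X)$.
   Context: $W_A(v)=\sum_{u\in N(v)\cap A}w(v,u)$, $W(v)=W_V(v)$. $S$ is a weighted partial positive influence dominating set if every $v\in V\setminus S$ satisfies $W_S(v)\ge W(v)/2$.
   Formalization: The edge weights of G are positive rationals. -}

module Defs where

open import Data.Nat using (ℕ; zero; suc)
open import Data.Fin using (Fin; zero; suc)
open import Data.Fin.Subset using (Subset; _∈_; _∉_)
open import Data.Vec using (lookup)
open import Data.Bool using (Bool; true; false; if_then_else_; _∧_; _∨_)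
open import Data.Rational using (ℚ; 0ℚ; ½; _+_; _*_; _<_; _≤_)
open import Data.Rational.Properties using (_≤?_)
open import Relation.Nullary using (does)
open import Relation.Binary.PropositionalEquality using (_≡_)

sumFin : {n : ℕ} → (Fin n → ℚ) → ℚ
sumFin {zero}  f = 0ℚ
sumFin {suc n} f = f zero + sumFin (λ i → f (suc i))

-- A finite (simple, undirected) graph on vertex set V = Fin n with
-- positive edge weights. adj encodes the edge set E; w u v is the weight
-- of the edge {u,v} (its values on non-edges are irrelevant).
record WGraph (n : ℕ) : Set where
  field
    adj       : Fin n → Fin n → Bool
    adj-sym   : ∀ u v → adj u v ≡ adj v u
    adj-irref : ∀ v → adj v v ≡ false
    w         : Fin n → Fin n → ℚ
    w-sym     : ∀ u v → w u v ≡ w v u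
    w-pos     : ∀ u v → adj u v ≡ true → 0ℚ < w u v

module _ {n : ℕ} (G : WGraph n) where
  open WGraph G

  W_ : Subset n → Fin n → ℚ
  W_ A v = sumFin (λ u → if adj v u ∧ lookup A u then w v u else 0ℚ)

  Wt : Fin n → ℚ
  Wt v = sumFin (λ u → if adj v u then w v u else 0ℚ)

  hv : Subset n → Fin n → ℚ
  hv A v = if lookup A v ∨ does (½ * Wt v ≤? W_ A v)
           then ½ * Wt v
           else W_ A v

  h : Subset n → ℚ
  h A = sumFin (hv A)

  IsWPPIDS : Subset n → Set
  IsWPPIDS S = ∀ v → v ∉ S → ½ * Wt v ≤ W_ S v

  IsMaxH : Subset n → Set
  IsMaxH S = ∀ (X : Subset n) → h X ≤ h S

{-# OPTIONS --safe #-}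
module Submission where

open import Defs
open import Data.Nat using (ℕ; zero; suc)
open import Data.Fin using (Fin; zero; suc)
open import Data.Fin.Subset using (Subset; _∉_; ⊤)
open import Data.Fin.Subset.Properties using (∈⊤)
open import Data.Vec using (lookup)
open import Data.Vec.Properties using (lookup⇒[]=; []=⇒lookup)
open import Data.Bool using (true; false; _∨_; if_then_else_)
open import Data.Empty using (⊥-elim)
open import Data.Rational using (ℚ; ½; _*_; _≤_; _<_)
open import Data.Rational.Properties
  using (≤-refl; ≤-trans; <⇒≤; ≰⇒>; <-irrefl; <-≤-trans; _≤?_; +-mono-≤; +-mono-<-≤; +-mono-≤-<)
open import Function.Bundles using (_⇔_; mk⇔; Equivalence)
open import Function.Construct.Composition using (_⇔-∘_)
open import Function.Construct.Identity using (⇔-id)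
open import Function.Related.TypeIsomorphisms using (→-cong-⇔)
open import Relation.Nullary using (Dec; yes; no; does; contradiction)
open import Relation.Binary.PropositionalEquality using (_≡_; refl; sym; trans)

-- h_A(v) never exceeds W(v)/2 and reaches it exactly when v lies in A or is
-- dominated by A. Hence h ≤ Σ_v W(v)/2 = h(V), and h(S) attains this bound
-- iff h_S(v) = W(v)/2 for every v, i.e. iff S is a WPPIDS.

sumFin-mono-≤ : ∀ {m} {f g : Fin m → ℚ} → (∀ i → f i ≤ g i) → sumFin f ≤ sumFin g
sumFin-mono-≤ {zero}  f≤g = ≤-refl
sumFin-mono-≤ {suc m} f≤g = +-mono-≤ (f≤g zero) (sumFin-mono-≤ (λ i → f≤g (suc i)))

sumFin-mono-< : ∀ {m} {f g : Fin m → ℚ} → (∀ i → f i ≤ g i) →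
                ∀ j → f j < g j → sumFin f < sumFin g
sumFin-mono-< {suc m} f≤g zero    fj<gj = +-mono-<-≤ fj<gj (sumFin-mono-≤ (λ i → f≤g (suc i)))
sumFin-mono-< {suc m} f≤g (suc j) fj<gj =
  +-mono-≤-< (f≤g zero) (sumFin-mono-< (λ i → f≤g (suc i)) j fj<gj)

sumFin-tight : ∀ {m} {f g : Fin m → ℚ} → (∀ i → f i ≤ g i) →
               sumFin g ≤ sumFin f → ∀ i → g i ≤ f i
sumFin-tight {f = f} {g} f≤g Σg≤Σf i with g i ≤? f i
... | yes gi≤fi = gi≤fi
... | no  gi≰fi = ⊥-elim (<-irrefl refl (<-≤-trans (sumFin-mono-< f≤g i (≰⇒> gi≰fi)) Σg≤Σf))

module _ {x y : ℚ} where

  if-∨-does≤ : ∀ b (x≤?y : Dec (x ≤ y)) → (if b ∨ does x≤?y then x else y) ≤ x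
  if-∨-does≤ true  _         = ≤-refl
  if-∨-does≤ false (yes _)   = ≤-refl
  if-∨-does≤ false (no  x≰y) = <⇒≤ (≰⇒> x≰y)

  ≤if-∨-does⇔ : ∀ b (x≤?y : Dec (x ≤ y)) →
                (x ≤ (if b ∨ does x≤?y then x else y)) ⇔ (b ≡ false → x ≤ y)
  ≤if-∨-does⇔ true  _         = mk⇔ (λ _ ()) (λ _ → ≤-refl)
  ≤if-∨-does⇔ false (yes x≤y) = mk⇔ (λ _ _ → x≤y) (λ _ → ≤-refl)
  ≤if-∨-does⇔ false (no  _)   = mk⇔ (λ x≤y _ → x≤y) (λ x≤y → x≤y refl)

lookup≡false⇔∉ : ∀ {n} (A : Subset n) v → lookup A v ≡ false ⇔ v ∉ A
lookup≡false⇔∉ A v = mk⇔ to from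
  where
  to : lookup A v ≡ false → v ∉ A
  to lookup≡false v∈A with () ← trans (sym ([]=⇒lookup v∈A)) lookup≡false

  from : v ∉ A → lookup A v ≡ false
  from v∉A with lookup A v in lookup≡b
  ... | true  = contradiction (lookup⇒[]= v A lookup≡b) v∉A
  ... | false = refl

module _ {n : ℕ} (G : WGraph n) where

  hv≤½Wt : ∀ A v → hv G A v ≤ ½ * Wt G v
  hv≤½Wt A v = if-∨-does≤ (lookup A v) (½ * Wt G v ≤? W_ G A v)

  ½Wt≤hv⇔dominated : ∀ A v → (½ * Wt G v ≤ hv G A v) ⇔ (v ∉ A → ½ * Wt G v ≤ W_ G A v)
  ½Wt≤hv⇔dominated A v =
    →-cong-⇔ (lookup≡false⇔∉ A v) (⇔-id _) ⇔-∘ ≤if-∨-does⇔ (lookup A v) (½ * Wt G v ≤? W_ G A v)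

  hMax : ℚ
  hMax = sumFin (λ v → ½ * Wt G v)

  h≤hMax : ∀ A → h G A ≤ hMax
  h≤hMax A = sumFin-mono-≤ (hv≤½Wt A)

  hMax≤h⊤ : hMax ≤ h G ⊤
  hMax≤h⊤ = sumFin-mono-≤ λ v →
    Equivalence.from (½Wt≤hv⇔dominated ⊤ v) (λ v∉⊤ → contradiction ∈⊤ v∉⊤)

lemma11 : ∀ (n : ℕ) (G : WGraph n) (S : Subset n) →
    IsWPPIDS G S ⇔ IsMaxH G S
lemma11 n G S = mk⇔ maximal dominating
  where
  maximal : IsWPPIDS G S → IsMaxH G S
  maximal wppids X =
    ≤-trans (h≤hMax G X) (sumFin-mono-≤ λ v →
      Equivalence.from (½Wt≤hv⇔dominated G S v) (wppids v))

  dominating : IsMaxH G S → IsWPPIDS G S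
  dominating max v =
    Equivalence.to (½Wt≤hv⇔dominated G S v)
      (sumFin-tight (hv≤½Wt G S) (≤-trans (hMax≤h⊤ G) (max ⊤)) v)
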